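{- Every claw-free graph has bipartite pathwidth at most $2$, and there exist graphs of bipartite pathwidth at most $2$ that are not claw-free.
   Context: The claw is $K_{1,3}$; a graph is claw-free if it has no induced claw. A path decomposition of $G=(V,E)$ is a sequence $(B_1,\dots,B_r)$ of subsets of $V$ such that every vertex lies in some $B_i$, every edge is contained in some $B_i$, and for each vertex $v$ the set $\{i: v\in B_i\}$ is an interval; its width is $\max_i|B_i|-1$, and the pathwidth is the minimum width. The bipartite pathwidth of $G$ is the maximum pathwidth of an induced bipartite subgraph of $G$. -}

module Defs where

open import Data.Nat using (ℕ; suc; _≤_)
open import Data.Bool using (Bool; true; false)
open import Data.Fin using (Fin) renaming (_≤_ to _≤ᶠ_)
open import Data.Fin.Subset using (Subset; _∈_; ∣_∣)
open import Data.Product using (Σ; ∃; _×_)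
open import Relation.Nullary using (¬_)
open import Relation.Binary.PropositionalEquality using (_≡_; _≢_)
open import Function.Definitions using (Injective)

record Graph (n : ℕ) : Set where
  field
    Adj     : Fin n → Fin n → Bool
    symm    : ∀ u v → Adj u v ≡ Adj v u
    irrefl  : ∀ v → Adj v v ≡ false
open Graph public

_~[_]_ : ∀ {n} → Fin n → Graph n → Fin n → Set
u ~[ G ] v = Adj G u v ≡ true

HasInducedClaw : ∀ {n} → Graph n → Set
HasInducedClaw {n} G =
  Σ (Fin n) λ c → Σ (Fin n) λ a → Σ (Fin n) λ b → Σ (Fin n) λ d →
    (c ~[ G ] a) × (c ~[ G ] b) × (c ~[ G ] d) ×
    (a ≢ b) × (a ≢ d) × (b ≢ d) ×
    ¬ (a ~[ G ] b) × ¬ (a ~[ G ] d) × ¬ (b ~[ G ] d)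

ClawFree : ∀ {n} → Graph n → Set
ClawFree G = ¬ HasInducedClaw G

induced : ∀ {n m} (G : Graph n) (f : Fin m → Fin n) → Graph m
induced G f = record
  { Adj    = λ i j → Adj G (f i) (f j)
  ; symm   = λ i j → symm G (f i) (f j)
  ; irrefl = λ i → irrefl G (f i)
  }

IsBipartite : ∀ {n} → Graph n → Set
IsBipartite {n} G = Σ (Fin n → Bool) λ col → ∀ u v → u ~[ G ] v → col u ≢ col v

IsPathDecomposition : ∀ {n} (G : Graph n) (r : ℕ) (bags : Fin r → Subset n) → Set
IsPathDecomposition {n} G r bags =
  (∀ (v : Fin n) → ∃ λ i → v ∈ bags i) ×
  (∀ (u v : Fin n) → u ~[ G ] v → ∃ λ i → (u ∈ bags i × v ∈ bags i)) ×
  (∀ (v : Fin n) (i j l : Fin r) → i ≤ᶠ j → j ≤ᶠ l →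
      v ∈ bags i → v ∈ bags l → v ∈ bags j)

PathwidthAtMost : ∀ {n} → Graph n → ℕ → Set
PathwidthAtMost {n} G k =
  Σ ℕ λ r → Σ (Fin r → Subset n) λ bags →
    IsPathDecomposition G r bags × (∀ i → ∣ bags i ∣ ≤ suc k)

BipartitePathwidthAtMost : ∀ {n} → Graph n → ℕ → Set
BipartitePathwidthAtMost {n} G k =
  ∀ (m : ℕ) (f : Fin m → Fin n) → Injective _≡_ _≡_ f →
    IsBipartite (induced G f) → PathwidthAtMost (induced G f) k

module Submission where

-- In a bipartite induced subgraph of a claw-free graph every vertex has at most two
-- neighbours: they all lie on the other side, so three of them would be the leaves of an
-- induced claw. A graph of maximum degree 2 is a disjoint union of paths and cycles; a path
-- x₀ … x_r has the bags {x_i, x_{i+1}}, and a cycle through v is such a path with v added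
-- to every bag, so the pathwidth is at most 2. Conversely every induced subgraph of the
-- claw is a star or edgeless, so the claw has bipartite pathwidth at most 2 as well.

open import Defs
open import Data.Nat using (ℕ; zero; suc; _≤_; z≤n; s≤s)
open import Data.Nat.Properties using (≤-trans; ≤-reflexive; ≤-pred; ≤-antisym; n≤1+n)
open import Data.Bool using (Bool; true; false; _xor_) renaming (_≟_ to _≟ᵇ_)
open import Data.Bool.Properties using (¬-not; xor-comm; xor-same)
open import Data.Fin using (Fin; zero; suc; toℕ; _≟_)
open import Data.Fin.Properties using (toℕ-injective; any?)
open import Data.Vec using (_∷_)
open import Data.Fin.Subset using (Subset; ⁅_⁆; _∪_; ∣_∣; outside; inside) renaming (_∈_ to _∈ₛ_; ⊥ to ∅)
open import Data.Fin.Subset.Properties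
  using (∪-identityˡ; ∣p∣≤∣x∷p∣; ∣⁅x⁆∣≡1; ∣⊥∣≡0; x∈p∪q⁺; x∈p∪q⁻; x∈⁅x⁆; x∈⁅y⁆⇒x≡y; ∉⊥)
open import Data.List using (List; []; _∷_; length; filter; foldr; allFin; lookup)
open import Data.List.Properties using (filter-notAll; length-filter; length-tabulate)
open import Data.List.Relation.Unary.All using (All; []; _∷_)
import Data.List.Relation.Unary.All as All
open import Data.List.Relation.Unary.Any using (Any; here; there)
import Data.List.Relation.Unary.Any as Any
open import Data.List.Relation.Unary.Any.Properties using (lookup-index)
open import Data.List.Membership.Propositional using (_∈_; _∉_; find; lose)
open import Data.List.Membership.Propositional.Properties using (∈-filter⁺; ∈-filter⁻; ∈-allFin; ∈-lookup)
open import Data.List.Relation.Binary.Subset.Propositional using (_⊆_)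
open import Data.Product using (Σ; Σ-syntax; _×_; _,_; proj₁; proj₂; swap; uncurry)
open import Data.Sum using (_⊎_; inj₁; inj₂; [_,_]′)
import Data.Sum as Sum
open import Data.Empty using (⊥; ⊥-elim)
open import Data.Unit using (⊤; tt)
open import Function using (_∘_; id)
open import Function.Definitions using (Injective)
open import Relation.Nullary using (¬_; Dec; yes; no; ¬?)
open import Relation.Nullary.Decidable using (_×-dec_; decidable-stable)
open import Relation.Binary.PropositionalEquality using (_≡_; _≢_; refl; sym; trans; ≢-sym)

~-sym : ∀ {n} (G : Graph n) {u v} → u ~[ G ] v → v ~[ G ] u
~-sym G {u} {v} u~v = trans (symm G v u) u~v

~-irrefl : ∀ {n} (G : Graph n) {v} → ¬ v ~[ G ] v
~-irrefl G {v} v~v with trans (sym (irrefl G v)) v~v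
... | ()

∣⁅x⁆∪p∣≤1+∣p∣ : ∀ {n} (x : Fin n) (p : Subset n) → ∣ ⁅ x ⁆ ∪ p ∣ ≤ suc ∣ p ∣
∣⁅x⁆∪p∣≤1+∣p∣ zero    (b ∷ p)       rewrite ∪-identityˡ p = s≤s (∣p∣≤∣x∷p∣ b p)
∣⁅x⁆∪p∣≤1+∣p∣ (suc x) (outside ∷ p) = ∣⁅x⁆∪p∣≤1+∣p∣ x p
∣⁅x⁆∪p∣≤1+∣p∣ (suc x) (inside ∷ p)  = s≤s (∣⁅x⁆∪p∣≤1+∣p∣ x p)

fromList : ∀ {n} → List (Fin n) → Subset n
fromList = foldr (λ x p → ⁅ x ⁆ ∪ p) ∅

module _ {n : ℕ} where

  ∈-fromList⁺ : ∀ {x : Fin n} {xs} → x ∈ xs → x ∈ₛ fromList xs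
  ∈-fromList⁺ (here refl) = x∈p∪q⁺ (inj₁ (x∈⁅x⁆ _))
  ∈-fromList⁺ (there x∈xs) = x∈p∪q⁺ (inj₂ (∈-fromList⁺ x∈xs))

  ∈-fromList⁻ : ∀ {x : Fin n} xs → x ∈ₛ fromList xs → x ∈ xs
  ∈-fromList⁻ []       x∈ = ⊥-elim (∉⊥ x∈)
  ∈-fromList⁻ (y ∷ xs) x∈ with x∈p∪q⁻ ⁅ y ⁆ (fromList xs) x∈
  ... | inj₁ x∈⁅y⁆ = here (x∈⁅y⁆⇒x≡y y x∈⁅y⁆)
  ... | inj₂ x∈xs  = there (∈-fromList⁻ xs x∈xs)

  ∣fromList∣≤length : ∀ (xs : List (Fin n)) → ∣ fromList xs ∣ ≤ length xs
  ∣fromList∣≤length []       = ≤-reflexive (∣⊥∣≡0 n)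
  ∣fromList∣≤length (x ∷ xs) = ≤-trans (∣⁅x⁆∪p∣≤1+∣p∣ x (fromList xs)) (s≤s (∣fromList∣≤length xs))

  -- Abstract, so that unification can recover A from remove a A.
  abstract
    remove : Fin n → List (Fin n) → List (Fin n)
    remove a = filter (λ x → ¬? (x ≟ a))

    ∈-remove⁺ : ∀ {a w A} → w ∈ A → w ≢ a → w ∈ remove a A
    ∈-remove⁺ {a} w∈A w≢a = ∈-filter⁺ (λ x → ¬? (x ≟ a)) w∈A w≢a

    ∈-remove⁻ : ∀ {a w A} → w ∈ remove a A → w ∈ A
    ∈-remove⁻ {a} {A = A} w∈ = proj₁ (∈-filter⁻ (λ x → ¬? (x ≟ a)) {xs = A} w∈)

    ∈-remove-≢ : ∀ {a w A} → w ∈ remove a A → w ≢ a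
    ∈-remove-≢ {a} {A = A} w∈ = proj₂ (∈-filter⁻ (λ x → ¬? (x ≟ a)) {xs = A} w∈)

    length-remove≤ : ∀ a A → length (remove a A) ≤ length A
    length-remove≤ a = length-filter (λ x → ¬? (x ≟ a))

    length-remove< : ∀ {a A k} → a ∈ A → length A ≤ suc k → length (remove a A) ≤ k
    length-remove< {a} {A} a∈A len =
      ≤-pred (≤-trans (filter-notAll (λ x → ¬? (x ≟ a)) A (Any.map (λ { refl a≢a → a≢a refl }) a∈A)) len)

  ∈-remove-split : ∀ {a w A} → w ∈ A → w ∈ remove a A ⊎ w ≡ a
  ∈-remove-split {a} {w} w∈A with w ≟ a
  ... | yes w≡a = inj₂ w≡a
  ... | no  w≢a = inj₁ (∈-remove⁺ w∈A w≢a)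

  ∷-remove-⊆ : ∀ {a A} → a ∈ A → a ∷ remove a A ⊆ A
  ∷-remove-⊆ a∈A (here refl) = a∈A
  ∷-remove-⊆ a∈A (there w∈) = ∈-remove⁻ w∈

  ⊆-∷-remove : ∀ {a A} → A ⊆ a ∷ remove a A
  ⊆-∷-remove w∈A = [ there , here ]′ (∈-remove-split w∈A)

module ListDecomposition {m : ℕ} (H : Graph m) (k : ℕ) where

  Bag : Set
  Bag = List (Fin m)

  Occurs : Fin m → List Bag → Set
  Occurs w = Any (w ∈_)

  InHead : Fin m → List Bag → Set
  InHead w []      = ⊥
  InHead w (B ∷ _) = w ∈ B

  Contiguous : List Bag → Set
  Contiguous []      = ⊤
  Contiguous (B ∷ D) = (∀ {w} → w ∈ B → Occurs w D → InHead w D) × Contiguous D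

  record Decomp (A : List (Fin m)) : Set where
    field
      bags       : List Bag
      bounded    : All (λ B → length B ≤ suc k) bags
      sound      : ∀ {w} → Occurs w bags → w ∈ A
      complete   : ∀ {w} → w ∈ A → Occurs w bags
      edges      : ∀ {u w} → u ∈ A → w ∈ A → u ~[ H ] w → Any (λ B → u ∈ B × w ∈ B) bags
      contiguous : Contiguous bags
  open Decomp public

  Starts : ∀ {A} → Fin m → Decomp A → Set
  Starts w d = InHead w (bags d)

  empty : Decomp []
  empty = record
    { bags = [] ; bounded = [] ; sound = λ () ; complete = λ () ; edges = λ () ; contiguous = tt }

  Decomp-cong : ∀ {A A'} → A ⊆ A' → A' ⊆ A → Decomp A → Decomp A'
  Decomp-cong A⊆A' A'⊆A d = record
    { bags       = bags d
    ; bounded    = bounded d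
    ; sound      = A⊆A' ∘ sound d
    ; complete   = complete d ∘ A'⊆A
    ; edges      = λ u∈ w∈ → edges d (A'⊆A u∈) (A'⊆A w∈)
    ; contiguous = contiguous d
    }

  prepend : ∀ {A A'} (B : Bag) (d : Decomp A') → length B ≤ suc k →
            B ⊆ A → A' ⊆ A → (∀ {w} → w ∈ A → w ∈ A' ⊎ w ∈ B) →
            (∀ {w} → w ∈ B → w ∈ A' → Starts w d) →
            (∀ {u w} → u ∈ B → w ∈ A → u ~[ H ] w → w ∈ B ⊎ (u ∈ A' × w ∈ A')) →
            Decomp A
  prepend {A} {A'} B d small B⊆A A'⊆A split shared closed = record
    { bags       = B ∷ bags d
    ; bounded    = small ∷ bounded d
    ; sound      = λ { (here w∈B) → B⊆A w∈B ; (there o) → A'⊆A (sound d o) }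
    ; complete   = [ there ∘ complete d , here ]′ ∘ split
    ; edges      = covered
    ; contiguous = (λ w∈B o → shared w∈B (sound d o)) , contiguous d
    }
    where
    fromB : ∀ {u w} → u ∈ B → w ∈ A → u ~[ H ] w → Any (λ B' → u ∈ B' × w ∈ B') (B ∷ bags d)
    fromB u∈B w∈A u~w =
      [ (λ w∈B → here (u∈B , w∈B)) , uncurry (λ u∈A' w∈A' → there (edges d u∈A' w∈A' u~w)) ]′
        (closed u∈B w∈A u~w)

    covered : ∀ {u w} → u ∈ A → w ∈ A → u ~[ H ] w → Any (λ B' → u ∈ B' × w ∈ B') (B ∷ bags d)
    covered u∈A w∈A u~w with split u∈A | split w∈A
    ... | inj₁ u∈A' | inj₁ w∈A' = there (edges d u∈A' w∈A' u~w)
    ... | inj₂ u∈B  | _         = fromB u∈B w∈A u~w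
    ... | inj₁ _    | inj₂ w∈B  = Any.map swap (fromB w∈B u∈A (~-sym H u~w))

  contiguous⇒interval : ∀ {w} D → Contiguous D → (i j l : Fin (length D)) →
                        toℕ i ≤ toℕ j → toℕ j ≤ toℕ l →
                        w ∈ lookup D i → w ∈ lookup D l → w ∈ lookup D j
  contiguous⇒interval (B ∷ D)      _        zero    zero    l       _         _         w∈i _   = w∈i
  contiguous⇒interval (B ∷ [])     _        zero    (suc ()) l      _         _         _   _
  contiguous⇒interval (B ∷ B' ∷ D) (c , cD) zero    (suc j) (suc l) _         (s≤s j≤l) w∈i w∈l =
    contiguous⇒interval (B' ∷ D) cD zero j l z≤n j≤l (c w∈i (lose (∈-lookup l) w∈l)) w∈l
  contiguous⇒interval (B ∷ D)      (_ , cD) (suc i) (suc j) (suc l) (s≤s i≤j) (s≤s j≤l) w∈i w∈l =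
    contiguous⇒interval D cD i j l i≤j j≤l w∈i w∈l

  toPathwidth : Decomp (allFin m) → PathwidthAtMost H k
  toPathwidth d = length (bags d) , bag , (cover , edge , interval) , small
    where
    bag : Fin (length (bags d)) → Subset m
    bag i = fromList (lookup (bags d) i)

    cover : ∀ v → Σ[ i ∈ Fin (length (bags d)) ] v ∈ₛ bag i
    cover v = let o = complete d (∈-allFin v) in Any.index o , ∈-fromList⁺ (lookup-index o)

    edge : ∀ u v → u ~[ H ] v → Σ[ i ∈ Fin (length (bags d)) ] u ∈ₛ bag i × v ∈ₛ bag i
    edge u v u~v = let o = edges d (∈-allFin u) (∈-allFin v) u~v in
      Any.index o , ∈-fromList⁺ (proj₁ (lookup-index o)) , ∈-fromList⁺ (proj₂ (lookup-index o))

    interval : ∀ v i j l → toℕ i ≤ toℕ j → toℕ j ≤ toℕ l → v ∈ₛ bag i → v ∈ₛ bag l → v ∈ₛ bag j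
    interval v i j l i≤j j≤l v∈i v∈l = ∈-fromList⁺
      (contiguous⇒interval (bags d) (contiguous d) i j l i≤j j≤l (∈-fromList⁻ _ v∈i) (∈-fromList⁻ _ v∈l))

    small : ∀ i → ∣ bag i ∣ ≤ suc k
    small i = ≤-trans (∣fromList∣≤length (lookup (bags d) i)) (All.lookup (bounded d) (∈-lookup i))

MaxDegree≤2 : ∀ {n} → Graph n → Set
MaxDegree≤2 {n} G =
  ∀ (c a b d : Fin n) → c ~[ G ] a → c ~[ G ] b → c ~[ G ] d → a ≢ b → a ≢ d → b ≢ d → ⊥

module MaxDegreeTwo {m : ℕ} (H : Graph m) (maxDegree≤2 : MaxDegree≤2 H) where

  open ListDecomposition H 2

  private
    V : Set
    V = Fin m

    _~_ : V → V → Set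
    u ~ w = u ~[ H ] w

    _~?_ : ∀ u w → Dec (u ~ w)
    u ~? w = Adj H u w ≟ᵇ true

  Deg≤1 : V → List V → Set
  Deg≤1 e A = ∀ {x y} → x ∈ A → y ∈ A → e ~ x → e ~ y → x ≡ y

  Deg≤1-⊆ : ∀ {e A A'} → A' ⊆ A → Deg≤1 e A → Deg≤1 e A'
  Deg≤1-⊆ A'⊆A deg x∈ y∈ = deg (A'⊆A x∈) (A'⊆A y∈)

  Deg≤1-remove : ∀ {v c} A → v ~ c → Deg≤1 c (remove v A)
  Deg≤1-remove A v~c {x} {y} x∈ y∈ c~x c~y = decidable-stable (x ≟ y) λ x≢y →
    maxDegree≤2 _ _ _ _ (~-sym H v~c) c~x c~y (≢-sym (∈-remove-≢ x∈)) (≢-sym (∈-remove-≢ y∈)) x≢y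

  neighbour≡either : ∀ {v a b x} → v ~ a → v ~ b → a ≢ b → v ~ x → x ≡ a ⊎ x ≡ b
  neighbour≡either {a = a} {b} {x} v~a v~b a≢b v~x with x ≟ a | x ≟ b
  ... | yes x≡a | _       = inj₁ x≡a
  ... | no  _   | yes x≡b = inj₂ x≡b
  ... | no  x≢a | no  x≢b = ⊥-elim (maxDegree≤2 _ _ _ _ v~a v~b v~x a≢b (≢-sym x≢a) (≢-sym x≢b))

  record TwoNeighbours (v : V) (A : List V) : Set where
    field
      {a b} : V
      a∈A   : a ∈ A
      b∈A   : b ∈ A
      v~a   : v ~ a
      v~b   : v ~ b
      a≢b   : a ≢ b

  degree? : ∀ e A → Deg≤1 e A ⊎ TwoNeighbours e A
  degree? e A with Any.any? (λ x → Any.any? (λ y → (e ~? x) ×-dec (e ~? y) ×-dec ¬? (x ≟ y)) A) A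
  ... | yes two with find two
  ...   | _ , x∈ , two′ with find two′
  ...     | _ , y∈ , e~x , e~y , x≢y =
    inj₂ (record { a∈A = x∈ ; b∈A = y∈ ; v~a = e~x ; v~b = e~y ; a≢b = x≢y })
  degree? e A | no ¬two = inj₁ λ {x} {y} x∈ y∈ e~x e~y →
    decidable-stable (x ≟ y) λ x≢y → ¬two (lose x∈ (lose y∈ (e~x , e~y , x≢y)))

  Deg≤1Vertex : List V → Set
  Deg≤1Vertex A = Σ[ e ∈ V ] e ∈ A × Deg≤1 e A

  DecompFrom : V → V → List V → Set
  DecompFrom v a A = Σ[ d ∈ Decomp A ] Starts v d × Starts a d

  prependIsolated : ∀ {e A} → e ∈ A → ¬ Any (e ~_) (remove e A) → Decomp (remove e A) →
                    Σ[ d ∈ Decomp A ] Starts e d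
  prependIsolated {e} {A} e∈A isolated d =
    prepend (e ∷ []) d (s≤s z≤n) (λ { (here refl) → e∈A }) ∈-remove⁻
      (Sum.map₂ here ∘ ∈-remove-split) (λ { (here refl) w∈ → ⊥-elim (∈-remove-≢ w∈ refl) }) closed
    , here refl
    where
    closed : ∀ {u w} → u ∈ e ∷ [] → w ∈ A → u ~ w → w ∈ e ∷ [] ⊎ (u ∈ remove e A × w ∈ remove e A)
    closed (here refl) w∈A e~w =
      ⊥-elim (isolated (lose (∈-remove⁺ w∈A λ { refl → ~-irrefl H e~w }) e~w))

  prependPendant : ∀ {e u A} → e ∈ A → Deg≤1 e A → u ∈ remove e A → e ~ u →
                   Σ[ d ∈ Decomp (remove e A) ] Starts u d → Σ[ d ∈ Decomp A ] Starts e d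
  prependPendant {e} {u} {A} e∈A deg u∈ e~u (d , u∈d) =
    prepend (u ∷ e ∷ []) d (s≤s (s≤s z≤n)) B⊆A ∈-remove⁻
      (Sum.map₂ (there ∘ here) ∘ ∈-remove-split) shared closed
    , there (here refl)
    where
    B⊆A : u ∷ e ∷ [] ⊆ A
    B⊆A (here refl)         = ∈-remove⁻ u∈
    B⊆A (there (here refl)) = e∈A

    shared : ∀ {w} → w ∈ u ∷ e ∷ [] → w ∈ remove e A → Starts w d
    shared (here refl)         _  = u∈d
    shared (there (here refl)) w∈ = ⊥-elim (∈-remove-≢ w∈ refl)

    closed : ∀ {x w} → x ∈ u ∷ e ∷ [] → w ∈ A → x ~ w →
             w ∈ u ∷ e ∷ [] ⊎ (x ∈ remove e A × w ∈ remove e A)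
    closed (here refl) w∈A _ = [ (λ w∈ → inj₂ (u∈ , w∈)) , (inj₁ ∘ there ∘ here) ]′ (∈-remove-split w∈A)
    closed (there (here refl)) w∈A e~w = inj₁ (here (deg w∈A (∈-remove⁻ u∈) e~w e~u))

  -- A walk from a neighbour of v towards its other neighbour b: v has been taken out of the
  -- unvisited vertices A and goes into every bag, a is the current vertex, reached from p,
  -- and T is the vertex set the walk started in. A walk that gets stuck before b shows that
  -- the component of v is a path, and leaves a at one of its ends.
  record Walk (T A : List V) (v a b p : V) : Set where
    field
      a∈A    : a ∈ A
      b∈A    : b ∈ A
      a≢b    : a ≢ b
      v∉A    : v ∉ A
      deg-a  : Deg≤1 a A
      deg-b  : Deg≤1 b A
      v-nbrs : ∀ {w} → w ∈ A → v ~ w → w ≡ a ⊎ w ≡ b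
      A⊆T    : A ⊆ T
      a-nbrs : ∀ {u} → u ∈ T → a ~ u → u ∈ A ⊎ u ≡ p
      A-nbrs : ∀ {w u} → w ∈ A → w ≢ a → u ∈ T → w ~ u → u ∈ A ⊎ u ≡ v

  startWalk : ∀ {A v} (two : TwoNeighbours v A) →
              Walk A (remove v A) v (TwoNeighbours.a two) (TwoNeighbours.b two) v
  startWalk {A} record { a∈A = a∈A ; b∈A = b∈A ; v~a = v~a ; v~b = v~b ; a≢b = a≢b } = record
    { a∈A    = ∈-remove⁺ a∈A λ { refl → ~-irrefl H v~a }
    ; b∈A    = ∈-remove⁺ b∈A λ { refl → ~-irrefl H v~b }
    ; a≢b    = a≢b
    ; v∉A    = λ v∈ → ∈-remove-≢ v∈ refl
    ; deg-a  = Deg≤1-remove A v~a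
    ; deg-b  = Deg≤1-remove A v~b
    ; v-nbrs = λ _ → neighbour≡either v~a v~b a≢b
    ; A⊆T    = ∈-remove⁻
    ; a-nbrs = λ u∈A _ → ∈-remove-split u∈A
    ; A-nbrs = λ _ _ u∈A _ → ∈-remove-split u∈A
    }

  stuck : ∀ {T A v a b p} → Walk T A v a b p → ¬ Any (a ~_) A → Deg≤1 a T
  stuck {T} {a = a} {p = p} walk isolated x∈ y∈ a~x a~y = trans (previous x∈ a~x) (sym (previous y∈ a~y))
    where
    previous : ∀ {u} → u ∈ T → a ~ u → u ≡ p
    previous u∈T a~u = [ (λ u∈A → ⊥-elim (isolated (lose u∈A a~u))) , id ]′ (Walk.a-nbrs walk u∈T a~u)

  advance : ∀ {T A v a b p a'} → Walk T A v a b p → a' ∈ A → a ~ a' → a' ≢ b →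
            Walk T (remove a A) v a' b a
  advance {T} {A} {v} {a} {b} {a' = a'} walk a'∈A a~a' a'≢b = record
    { a∈A    = ∈-remove⁺ a'∈A a'≢a
    ; b∈A    = ∈-remove⁺ b∈A (≢-sym a≢b)
    ; a≢b    = a'≢b
    ; v∉A    = v∉A ∘ ∈-remove⁻
    ; deg-a  = Deg≤1-remove A a~a'
    ; deg-b  = Deg≤1-⊆ ∈-remove⁻ deg-b
    ; v-nbrs = λ w∈ v~w → inj₂ (v-nbr≢a w∈ v~w)
    ; A⊆T    = A⊆T ∘ ∈-remove⁻
    ; a-nbrs = a'-nbrs
    ; A-nbrs = rest-nbrs
    }
    where
    open Walk walk

    a'≢a : a' ≢ a
    a'≢a refl = ~-irrefl H a~a'

    v-nbr≢a : ∀ {w} → w ∈ remove a A → v ~ w → w ≡ b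
    v-nbr≢a w∈ v~w = [ (λ w≡a → ⊥-elim (∈-remove-≢ w∈ w≡a)) , id ]′ (v-nbrs (∈-remove⁻ w∈) v~w)

    a'-nbrs : ∀ {u} → u ∈ T → a' ~ u → u ∈ remove a A ⊎ u ≡ a
    a'-nbrs u∈T a'~u with A-nbrs a'∈A a'≢a u∈T a'~u
    ... | inj₁ u∈A = ∈-remove-split u∈A
    ... | inj₂ refl = ⊥-elim ([ a'≢a , a'≢b ]′ (v-nbrs a'∈A (~-sym H a'~u)))

    rest-nbrs : ∀ {w u} → w ∈ remove a A → w ≢ a' → u ∈ T → w ~ u → u ∈ remove a A ⊎ u ≡ v
    rest-nbrs w∈ w≢a' u∈T w~u with A-nbrs (∈-remove⁻ w∈) (∈-remove-≢ w∈) u∈T w~u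
    ... | inj₂ u≡v = inj₂ u≡v
    ... | inj₁ u∈A with ∈-remove-split u∈A
    ...   | inj₁ u∈ = inj₁ u∈
    ...   | inj₂ refl = ⊥-elim (w≢a' (deg-a (∈-remove⁻ w∈) a'∈A (~-sym H w~u) a~a'))

  extend : ∀ {T A v a b p a'} → Walk T A v a b p → a' ∈ A → a ~ a' →
           DecompFrom v a' (v ∷ remove a A) → DecompFrom v a (v ∷ A)
  extend {A = A} {v} {a} {a' = a'} walk a'∈A a~a' (d , v∈d , a'∈d) =
    prepend B d (s≤s (s≤s (s≤s z≤n))) B⊆ A'⊆ split shared closed
    , there (there (here refl)) , there (here refl)
    where
    open Walk walk
    B A' : List V
    B  = a' ∷ a ∷ v ∷ []
    A' = v ∷ remove a A

    a'∈A' : a' ∈ A'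
    a'∈A' = there (∈-remove⁺ a'∈A λ { refl → ~-irrefl H a~a' })

    B⊆ : B ⊆ v ∷ A
    B⊆ (here refl)                 = there a'∈A
    B⊆ (there (here refl))         = there a∈A
    B⊆ (there (there (here refl))) = here refl

    A'⊆ : A' ⊆ v ∷ A
    A'⊆ (here refl) = here refl
    A'⊆ (there w∈)  = there (∈-remove⁻ w∈)

    split : ∀ {w} → w ∈ v ∷ A → w ∈ A' ⊎ w ∈ B
    split (here refl) = inj₁ (here refl)
    split (there w∈A) = Sum.map there (there ∘ here) (∈-remove-split w∈A)

    shared : ∀ {w} → w ∈ B → w ∈ A' → Starts w d
    shared (here refl)                 _           = a'∈d
    shared (there (here refl))         (here refl) = ⊥-elim (v∉A a∈A)
    shared (there (here refl))         (there w∈)  = ⊥-elim (∈-remove-≢ w∈ refl)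
    shared (there (there (here refl))) _           = v∈d

    through : ∀ {u w} → u ∈ A' → w ∈ v ∷ A → w ∈ B ⊎ (u ∈ A' × w ∈ A')
    through u∈A' w∈ = [ (λ w∈A' → inj₂ (u∈A' , w∈A')) , inj₁ ]′ (split w∈)

    closed : ∀ {u w} → u ∈ B → w ∈ v ∷ A → u ~ w → w ∈ B ⊎ (u ∈ A' × w ∈ A')
    closed (here refl)                 w∈          _   = through a'∈A' w∈
    closed (there (here refl))         (here refl) _   = inj₁ (there (there (here refl)))
    closed (there (here refl))         (there w∈A) a~w = inj₁ (here (deg-a w∈A a'∈A a~w a~a'))
    closed (there (there (here refl))) w∈          _   = through (here refl) w∈

  closeCycle : ∀ {T A v a b p} → Walk T A v a b p → a ~ b →
               Decomp (remove b (remove a A)) → DecompFrom v a (v ∷ A)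
  closeCycle {A = A} {v} {a} {b} walk a~b d =
    prepend B d (s≤s (s≤s (s≤s z≤n))) B⊆ A'⊆ split shared (λ u∈ w∈ u~w → inj₁ (closed u∈ w∈ u~w))
    , there (there (here refl)) , here refl
    where
    open Walk walk
    B A' : List V
    B  = a ∷ b ∷ v ∷ []
    A' = remove b (remove a A)

    B⊆ : B ⊆ v ∷ A
    B⊆ (here refl)                 = there a∈A
    B⊆ (there (here refl))         = there b∈A
    B⊆ (there (there (here refl))) = here refl

    A'⊆ : A' ⊆ v ∷ A
    A'⊆ = there ∘ ∈-remove⁻ ∘ ∈-remove⁻

    split : ∀ {w} → w ∈ v ∷ A → w ∈ A' ⊎ w ∈ B
    split (here refl) = inj₂ (there (there (here refl)))
    split (there w∈A) with ∈-remove-split w∈A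
    ... | inj₂ w≡a = inj₂ (here w≡a)
    ... | inj₁ w∈ = Sum.map₂ (there ∘ here) (∈-remove-split w∈)

    shared : ∀ {w} → w ∈ B → w ∈ A' → Starts w d
    shared (here refl)                 w∈ = ⊥-elim (∈-remove-≢ (∈-remove⁻ w∈) refl)
    shared (there (here refl))         w∈ = ⊥-elim (∈-remove-≢ w∈ refl)
    shared (there (there (here refl))) w∈ = ⊥-elim (v∉A (∈-remove⁻ (∈-remove⁻ w∈)))

    closed : ∀ {u w} → u ∈ B → w ∈ v ∷ A → u ~ w → w ∈ B
    closed _                           (here refl) _   = there (there (here refl))
    closed (here refl)                 (there w∈A) a~w = there (here (deg-a w∈A b∈A a~w a~b))
    closed (there (here refl))         (there w∈A) b~w = here (deg-b w∈A a∈A b~w (~-sym H a~b))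
    closed (there (there (here refl))) (there w∈A) v~w = [ here , there ∘ here ]′ (v-nbrs w∈A v~w)

  WalkResult : List V → List V → V → V → Set
  WalkResult T A v a = DecompFrom v a (v ∷ A) ⊎ Deg≤1Vertex T

  decompose : ∀ n A → length A ≤ n → Decomp A
  pathFrom  : ∀ n A → length A ≤ n → (e : Deg≤1Vertex A) → Σ[ d ∈ Decomp A ] Starts (proj₁ e) d
  walk      : ∀ n {T A v a b p} → length A ≤ n → Walk T A v a b p → WalkResult T A v a

  -- pathFrom is called at the same fuel here, which the termination checker accepts only
  -- outside with-clauses, hence the eliminators.
  decompose _       []      _ = empty
  decompose zero    (_ ∷ _) ()
  decompose (suc n) (v ∷ A) len =
    [ (λ (deg : Deg≤1 v (v ∷ A)) → proj₁ (pathFrom (suc n) (v ∷ A) len (v , here refl , deg)))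
    , (λ two → [ Decomp-cong (∷-remove-⊆ (here refl)) ⊆-∷-remove ∘ proj₁
               , proj₁ ∘ pathFrom (suc n) (v ∷ A) len
               ]′ (walk n (length-remove< (here refl) len) (startWalk two)))
    ]′ (degree? v (v ∷ A))

  pathFrom _       []      _  (_ , () , _)
  pathFrom zero    (_ ∷ _) ()
  pathFrom (suc n) A       len (e , e∈A , deg) with Any.any? (e ~?_) (remove e A)
  ... | no isolated = prependIsolated e∈A isolated (decompose n (remove e A) (length-remove< e∈A len))
  ... | yes nbr with find nbr
  ...   | u , u∈ , e~u = prependPendant e∈A deg u∈ e~u
                           (pathFrom n (remove e A) (length-remove< e∈A len) (u , u∈ , Deg≤1-remove A e~u))

  walk zero    {A = _ ∷ _} () _
  walk zero    {A = []}    _  record { a∈A = () }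
  walk (suc n) {A = A} {a = a} {b} len w with Any.any? (a ~?_) A
  ... | no isolated = inj₂ (a , Walk.A⊆T w (Walk.a∈A w) , stuck w isolated)
  ... | yes nbr with find nbr
  ...   | a' , a'∈A , a~a' with a' ≟ b
  ...     | yes refl = inj₁ (closeCycle w a~a'
                         (decompose n _ (≤-trans (length-remove≤ a' _) (length-remove< (Walk.a∈A w) len))))
  ...     | no a'≢b = Sum.map₁ (extend w a'∈A a~a')
                        (walk n (length-remove< (Walk.a∈A w) len) (advance w a'∈A a~a' a'≢b))

maxDegree≤2⇒pathwidth≤2 : ∀ {m} (H : Graph m) → MaxDegree≤2 H → PathwidthAtMost H 2
maxDegree≤2⇒pathwidth≤2 {m} H maxDegree≤2 =
  toPathwidth (decompose m (allFin m) (≤-reflexive (length-tabulate id)))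
  where
  open ListDecomposition H 2
  open MaxDegreeTwo H maxDegree≤2

induced-clawFree : ∀ {n m} (G : Graph n) {f : Fin m → Fin n} →
                   Injective _≡_ _≡_ f → ClawFree G → ClawFree (induced G f)
induced-clawFree G {f} inj clawFree (c , a , b , d , c~a , c~b , c~d , a≢b , a≢d , b≢d , rest) =
  clawFree (f c , f a , f b , f d , c~a , c~b , c~d , a≢b ∘ inj , a≢d ∘ inj , b≢d ∘ inj , rest)

bipartite-clawFree⇒maxDegree≤2 : ∀ {n} (G : Graph n) → IsBipartite G → ClawFree G → MaxDegree≤2 G
bipartite-clawFree⇒maxDegree≤2 G (col , proper) clawFree c a b d c~a c~b c~d a≢b a≢d b≢d =
  clawFree (c , a , b , d , c~a , c~b , c~d , a≢b , a≢d , b≢d ,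
            nonadjacent c~a c~b , nonadjacent c~a c~d , nonadjacent c~b c~d)
  where
  nonadjacent : ∀ {x y} → c ~[ G ] x → c ~[ G ] y → ¬ x ~[ G ] y
  nonadjacent c~x c~y x~y =
    proper _ _ x~y (trans (¬-not (≢-sym (proper _ _ c~x))) (sym (¬-not (≢-sym (proper _ _ c~y)))))

clawFree⇒bipartitePathwidth≤2 : ∀ {n} (G : Graph n) → ClawFree G → BipartitePathwidthAtMost G 2
clawFree⇒bipartitePathwidth≤2 G clawFree m f inj bipartite =
  maxDegree≤2⇒pathwidth≤2 (induced G f)
    (bipartite-clawFree⇒maxDegree≤2 (induced G f) bipartite (induced-clawFree G inj clawFree))

star⇒pathwidth≤1 : ∀ {m} (G : Graph m) (c : Fin m) →
                   (∀ {u w} → u ~[ G ] w → u ≡ c ⊎ w ≡ c) → PathwidthAtMost G 1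
star⇒pathwidth≤1 {m} G c central = m , bag , (cover , edge , interval) , small
  where
  bag : Fin m → Subset m
  bag i = ⁅ i ⁆ ∪ ⁅ c ⁆

  cover : ∀ v → Σ[ i ∈ Fin m ] v ∈ₛ bag i
  cover v = v , x∈p∪q⁺ (inj₁ (x∈⁅x⁆ v))

  edge : ∀ u v → u ~[ G ] v → Σ[ i ∈ Fin m ] u ∈ₛ bag i × v ∈ₛ bag i
  edge u v u~v with central u~v
  ... | inj₁ refl = v , x∈p∪q⁺ (inj₂ (x∈⁅x⁆ c)) , x∈p∪q⁺ (inj₁ (x∈⁅x⁆ v))
  ... | inj₂ refl = u , x∈p∪q⁺ (inj₁ (x∈⁅x⁆ u)) , x∈p∪q⁺ (inj₂ (x∈⁅x⁆ c))

  interval : ∀ v i j l → toℕ i ≤ toℕ j → toℕ j ≤ toℕ l → v ∈ₛ bag i → v ∈ₛ bag l → v ∈ₛ bag j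
  interval v i j l i≤j j≤l v∈i v∈l with x∈p∪q⁻ ⁅ i ⁆ ⁅ c ⁆ v∈i | x∈p∪q⁻ ⁅ l ⁆ ⁅ c ⁆ v∈l
  ... | inj₂ v∈c | _        = x∈p∪q⁺ (inj₂ v∈c)
  ... | inj₁ _   | inj₂ v∈c = x∈p∪q⁺ (inj₂ v∈c)
  ... | inj₁ v∈i | inj₁ v∈l with x∈⁅y⁆⇒x≡y i v∈i | x∈⁅y⁆⇒x≡y l v∈l
  ...   | refl | refl rewrite toℕ-injective (≤-antisym i≤j j≤l) = x∈p∪q⁺ (inj₁ (x∈⁅x⁆ j))

  small : ∀ i → ∣ bag i ∣ ≤ 2
  small i = ≤-trans (∣⁅x⁆∪p∣≤1+∣p∣ i ⁅ c ⁆) (s≤s (≤-reflexive (∣⁅x⁆∣≡1 c)))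

PathwidthAtMost-mono : ∀ {n} {G : Graph n} {k k'} → k ≤ k' → PathwidthAtMost G k → PathwidthAtMost G k'
PathwidthAtMost-mono k≤k' (r , bags , isPD , small) = r , bags , isPD , λ i → ≤-trans (small i) (s≤s k≤k')

isCentre : ∀ {n} → Fin (suc n) → Bool
isCentre zero    = true
isCentre (suc _) = false

starGraph : ∀ n → Graph (suc n)
starGraph n = record
  { Adj    = λ u v → isCentre u xor isCentre v
  ; symm   = λ u v → xor-comm (isCentre u) (isCentre v)
  ; irrefl = λ v → xor-same (isCentre v)
  }

starGraph-central : ∀ {n} (u v : Fin (suc n)) → u ~[ starGraph n ] v → u ≡ zero ⊎ v ≡ zero
starGraph-central zero    _       _  = inj₁ refl
starGraph-central (suc _) zero    _  = inj₂ refl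
starGraph-central (suc _) (suc _) ()

starGraph-bipartitePathwidth≤2 : ∀ n → BipartitePathwidthAtMost (starGraph n) 2
starGraph-bipartitePathwidth≤2 n m f inj _ with any? (λ j → f j ≟ zero)
... | yes (c , fc≡0) = PathwidthAtMost-mono {G = induced (starGraph n) f} (n≤1+n 1)
  (star⇒pathwidth≤1 (induced (starGraph n) f) c λ {u} {w} →
    Sum.map centre≡c centre≡c ∘ starGraph-central (f u) (f w))
  where
  centre≡c : ∀ {u} → f u ≡ zero → u ≡ c
  centre≡c fu≡0 = inj (trans fu≡0 (sym fc≡0))
... | no noCentre = maxDegree≤2⇒pathwidth≤2 (induced (starGraph n) f) λ c a _ _ c~a _ _ _ _ _ →
  noCentre ([ (c ,_) , (a ,_) ]′ (starGraph-central (f c) (f a) c~a))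

claw : Graph 4
claw = starGraph 3

claw-not-clawFree : ¬ ClawFree claw
claw-not-clawFree clawFree = clawFree (zero , suc zero , suc (suc zero) , suc (suc (suc zero)) ,
  refl , refl , refl , (λ ()) , (λ ()) , (λ ()) , (λ ()) , (λ ()) , (λ ()))

lemma9 : ((n : ℕ) (G : Graph n) → ClawFree G → BipartitePathwidthAtMost G 2)
           × Σ ℕ (λ n → Σ (Graph n) (λ G → BipartitePathwidthAtMost G 2 × ¬ ClawFree G))
lemma9 = (λ n → clawFree⇒bipartitePathwidth≤2)
       , 4 , claw , starGraph-bipartitePathwidth≤2 3 , claw-not-clawFree
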